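{- For every positive integer $k$, $$\sum_{i=1}^{\infty}\frac{1}{i+k}\binom{2i}{i}\frac{1}{4^i}=\frac{1}{k}\binom{2k}{k}^{ -1}4^k-\frac{1}{k}.$$ -}

module Defs where

open import Data.Nat as ℕ using (ℕ; zero; suc; _≤_; _<_; z≤n; s≤s; NonZero)
open import Data.Nat.Properties as ℕP
open import Data.Nat.Combinatorics using (_C_; nCk+nC[k+1]≡[n+1]C[k+1])
open import Data.Integer using (+_)
open import Data.Rational using (ℚ; 0ℚ; _+_; _-_; _*_; _/_; _÷_; NonZero; >-nonZero)
open import Data.Rational.Properties using (positive⁻¹)
open import Relation.Binary.PropositionalEquality

nCk>0 : ∀ n k → k ≤ n → 0 < n C k
nCk>0 n zero _ = s≤s z≤n
nCk>0 (suc n) (suc k) (s≤s k≤n) =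
  subst (0 <_) (nCk+nC[k+1]≡[n+1]C[k+1] n k)
        (ℕP.<-≤-trans (nCk>0 n k k≤n) (ℕP.m≤m+n (n C k) (n C suc k)))

central : ℕ → ℕ
central k = (2 ℕ.* k) C k

central>0 : ∀ k → 0 < central k
central>0 k = nCk>0 (2 ℕ.* k) k (ℕP.m≤n*m k 2)

central≢0 : ∀ k → ℕ.NonZero (central k)
central≢0 k = ℕ.>-nonZero (central>0 k)

-- the i-th term (i ≥ 1) of the series, written for i = suc j:
--   1/(i+k) * binom(2i,i) * 1/4^i
term : ℕ → ℕ → ℚ
term k j = (+ 1 / (suc j ℕ.+ k)) * ((+ central (suc j)) / 1) * (+ 1 / (4 ℕ.^ suc j)) {{ℕP.m^n≢0 4 (suc j)}}

partialSum : ℕ → ℕ → ℚ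
partialSum k zero = 0ℚ
partialSum k (suc n) = partialSum k n + term k n

rhs : (k : ℕ) → .{{ℕ.NonZero k}} → ℚ
rhs k = (+ 1 / k) * (+ 1 / central k) {{central≢0 k}} * ((+ (4 ℕ.^ k)) / 1) - (+ 1 / k)

-- Write a n = C(2n,n)/4^n.  For k ≥ 1 the tail Σ_{i>n} a i/(i+k) equals a n · R k n, where
-- R k n = p k n / q k n is an explicit rational function of n.  It satisfies
-- R k n = (2n+1)/(2n+2) · (1/(n+1+k) + R k (n+1)) and R k 0 + 1/k = 4^k/(k C(2k,k)), so the
-- partial sums telescope: Σ_{i=1}^{n} = 4^k/(k C(2k,k)) − 1/k − a n · R k n exactly.  Finally
-- R k n ≤ 2 and a n² (2n+1) ≤ 1 bound the error by 2/√(2n+1).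
module Submission where

open import Defs

module CentralBinomial where
  open import Data.Nat
  open import Data.Nat.Properties
  open import Data.Nat.Combinatorics
  open import Data.Nat.Tactic.RingSolver
  open import Data.List using (_∷_; [])
  open import Relation.Binary.PropositionalEquality
  open import Relation.Nullary using (yes; no; contradiction)

  [1+k]*[1+n]C[1+k]≡[1+n]*nCk : ∀ n k → suc k * (suc n C suc k) ≡ suc n * (n C k)
  [1+k]*[1+n]C[1+k]≡[1+n]*nCk zero    zero    = refl
  [1+k]*[1+n]C[1+k]≡[1+n]*nCk zero    (suc k) = *-zeroʳ (suc (suc k))
  [1+k]*[1+n]C[1+k]≡[1+n]*nCk (suc n) zero    =
    trans (*-identityˡ _) (trans (nC1≡n (suc (suc n))) (sym (*-identityʳ (suc (suc n)))))
  [1+k]*[1+n]C[1+k]≡[1+n]*nCk (suc n) (suc k) = begin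
    suc (suc k) * (suc (suc n) C suc (suc k))
      ≡⟨ cong (suc (suc k) *_) (nCk+nC[k+1]≡[n+1]C[k+1] (suc n) (suc k)) ⟨
    suc (suc k) * (x + y)
      ≡⟨ distribute (suc k) x y ⟩
    x + (suc k * x + suc (suc k) * y)
      ≡⟨ cong₂ (λ u v → x + (u + v)) ([1+k]*[1+n]C[1+k]≡[1+n]*nCk n k) ([1+k]*[1+n]C[1+k]≡[1+n]*nCk n (suc k)) ⟩
    x + (suc n * (n C k) + suc n * (n C suc k))
      ≡⟨ cong (x +_) (*-distribˡ-+ (suc n) (n C k) (n C suc k)) ⟨
    x + suc n * (n C k + n C suc k)
      ≡⟨ cong (λ z → x + suc n * z) (nCk+nC[k+1]≡[n+1]C[k+1] n k) ⟩
    x + suc n * x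
      ∎
    where
    open ≡-Reasoning
    x = suc n C suc k
    y = suc n C suc (suc k)
    distribute : ∀ a x y → suc a * (x + y) ≡ x + (a * x + suc a * y)
    distribute = solve-∀

  [m+n]Cm≡[m+n]Cn : ∀ m n → (m + n) C m ≡ (m + n) C n
  [m+n]Cm≡[m+n]Cn m n = trans (nCk≡nC[n∸k] (m≤m+n m n)) (cong ((m + n) C_) (m+n∸m≡n m n))

  central-suc : ∀ n → suc n * central (suc n) ≡ 2 * (2 * n + 1) * central n
  central-suc n = begin
    suc n * ((2 * suc n) C suc n)
      ≡⟨ cong (λ m → suc n * (m C suc n)) 2*[1+n]≡2+2n ⟩
    suc n * (suc (suc (2 * n)) C suc n)
      ≡⟨ cong (suc n *_) (nCk+nC[k+1]≡[n+1]C[k+1] (suc (2 * n)) n) ⟨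
    suc n * (suc (2 * n) C n + suc (2 * n) C suc n)
      ≡⟨ cong (λ c → suc n * (c + suc (2 * n) C suc n)) middle-symmetric ⟩
    suc n * (suc (2 * n) C suc n + suc (2 * n) C suc n)
      ≡⟨ double (suc n) (suc (2 * n) C suc n) ⟩
    2 * (suc n * (suc (2 * n) C suc n))
      ≡⟨ cong (2 *_) ([1+k]*[1+n]C[1+k]≡[1+n]*nCk (2 * n) n) ⟩
    2 * (suc (2 * n) * central n)
      ≡⟨ reassociate (2 * n) (central n) ⟩
    2 * (2 * n + 1) * central n
      ∎
    where
    open ≡-Reasoning
    2*[1+n]≡2+2n : 2 * suc n ≡ suc (suc (2 * n))
    2*[1+n]≡2+2n = solve (n ∷ [])
    n+[1+n]≡1+2n : n + suc n ≡ suc (2 * n)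
    n+[1+n]≡1+2n = solve (n ∷ [])
    middle-symmetric : suc (2 * n) C n ≡ suc (2 * n) C suc n
    middle-symmetric = subst (λ m → m C n ≡ m C suc n) n+[1+n]≡1+2n ([m+n]Cm≡[m+n]Cn n (suc n))
    double : ∀ a c → a * (c + c) ≡ 2 * (a * c)
    double = solve-∀
    reassociate : ∀ m c → 2 * (suc m * c) ≡ 2 * (m + 1) * c
    reassociate = solve-∀

  -- The induction step is (2n+1)(2n+3) ≤ (2n+2)².
  central-square-bound : ∀ n → central n * central n * (2 * n + 1) ≤ 4 ^ n * 4 ^ n
  central-square-bound zero    = ≤-refl
  central-square-bound (suc n) = *-cancelˡ-≤ (suc n * suc n) (begin
    suc n * suc n * (c′ * c′ * (2 * suc n + 1))
      ≡⟨ regroup (suc n) c′ (2 * suc n + 1) ⟩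
    (suc n * c′) * (suc n * c′) * (2 * suc n + 1)
      ≡⟨ cong (λ z → z * z * (2 * suc n + 1)) (central-suc n) ⟩
    (2 * (2 * n + 1) * c) * (2 * (2 * n + 1) * c) * (2 * suc n + 1)
      ≡⟨ expand n c ⟩
    4 * (2 * n + 1) * (2 * n + 3) * (c * c * (2 * n + 1))
      ≤⟨ *-monoʳ-≤ (4 * (2 * n + 1) * (2 * n + 3)) (central-square-bound n) ⟩
    4 * (2 * n + 1) * (2 * n + 3) * (4 ^ n * 4 ^ n)
      ≤⟨ m≤m+n _ (4 * (4 ^ n * 4 ^ n)) ⟩
    4 * (2 * n + 1) * (2 * n + 3) * (4 ^ n * 4 ^ n) + 4 * (4 ^ n * 4 ^ n)
      ≡⟨ complete-square n (4 ^ n) ⟩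
    suc n * suc n * (4 ^ suc n * 4 ^ suc n)
      ∎)
    where
    open ≤-Reasoning
    c = central n
    c′ = central (suc n)
    regroup : ∀ m x y → m * m * (x * x * y) ≡ (m * x) * (m * x) * y
    regroup = solve-∀
    expand : ∀ n c → (2 * (2 * n + 1) * c) * (2 * (2 * n + 1) * c) * (2 * suc n + 1)
                     ≡ 4 * (2 * n + 1) * (2 * n + 3) * (c * c * (2 * n + 1))
    expand = solve-∀
    complete-square : ∀ n x → 4 * (2 * n + 1) * (2 * n + 3) * (x * x) + 4 * (x * x)
                              ≡ suc n * suc n * ((4 * x) * (4 * x))
    complete-square = solve-∀

  m*m<n*n⇒m<n : ∀ m n → m * m < n * n → m < n
  m*m<n*n⇒m<n m n m*m<n*n with m <? n
  ... | yes m<n = m<n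
  ... | no  m≮n = contradiction (*-mono-≤ (≮⇒≥ m≮n) (≮⇒≥ m≮n)) (<⇒≱ m*m<n*n)

  2*m*central<4^n : ∀ m n → 2 * m * m ≤ n → 2 * m * central n < 4 ^ n
  2*m*central<4^n m n 2m²≤n = m*m<n*n⇒m<n _ _ (*-cancelˡ-< (2 * n + 1) _ _ (begin-strict
    (2 * n + 1) * (2 * m * c * (2 * m * c))
      ≡⟨ regroup n m c ⟩
    4 * m * m * (c * c * (2 * n + 1))
      ≤⟨ *-monoʳ-≤ (4 * m * m) (central-square-bound n) ⟩
    4 * m * m * (z * z)
      <⟨ *-monoˡ-< (z * z) {{m*n≢0 z z {{z≢0}} {{z≢0}}}} 4m²<2n+1 ⟩
    (2 * n + 1) * (z * z)
      ∎))
    where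
    open ≤-Reasoning
    c = central n
    z = 4 ^ n
    z≢0 : NonZero z
    z≢0 = m^n≢0 4 n
    2[2m²]≡4m² : 2 * (2 * m * m) ≡ 4 * m * m
    2[2m²]≡4m² = solve (m ∷ [])
    4m²<2n+1 : 4 * m * m < 2 * n + 1
    4m²<2n+1 = ≤-<-trans (subst (_≤ 2 * n) 2[2m²]≡4m² (*-monoʳ-≤ 2 2m²≤n)) (m<m+n (2 * n) z<s)
    regroup : ∀ n m c → (2 * n + 1) * (2 * m * c * (2 * m * c)) ≡ 4 * m * m * (c * c * (2 * n + 1))
    regroup = solve-∀

module TailRatio where
  open import Data.Nat
  open import Data.Nat.Properties
  open import Data.Nat.Tactic.RingSolver
  open import Relation.Binary.PropositionalEquality
  open CentralBinomial

  -- Numerator and denominator of R k n, from R 0 n = 0 and (2k+1) R (k+1) n = 2k R k n + (2n+1)/(n+k+1).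
  p q : ℕ → ℕ → ℕ
  p zero    n = 0
  p (suc k) n = 2 * k * p k n * (n + k + 1) + (2 * n + 1) * q k n
  q zero    n = 1
  q (suc k) n = (2 * k + 1) * q k n * (n + k + 1)

  q≢0 : ∀ k n → NonZero (q k n)
  q≢0 zero    n = _
  q≢0 (suc k) n = m*n≢0 _ _ {{m*n≢0 _ _ {{m+1≢0 (2 * k)}} {{q≢0 k n}}}} {{m+1≢0 (n + k)}}
    where
    m+1≢0 : ∀ m → NonZero (m + 1)
    m+1≢0 m = ≢-nonZero (m+1+n≢0 m)

  p≤2q : ∀ k n → p k n ≤ 2 * q k n
  p≤2q zero    n = z≤n
  p≤2q (suc k) n = begin
    2 * k * p k n * (n + k + 1) + (2 * n + 1) * q k n
      ≤⟨ +-monoˡ-≤ _ (*-monoˡ-≤ (n + k + 1) (*-monoʳ-≤ (2 * k) (p≤2q k n))) ⟩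
    2 * k * (2 * q k n) * (n + k + 1) + (2 * n + 1) * q k n
      ≤⟨ m≤m+n _ ((2 * k + 1) * q k n) ⟩
    2 * k * (2 * q k n) * (n + k + 1) + (2 * n + 1) * q k n + (2 * k + 1) * q k n
      ≡⟨ collect k n (q k n) ⟩
    2 * ((2 * k + 1) * q k n * (n + k + 1))
      ∎
    where
    open ≤-Reasoning
    collect : ∀ k n c → 2 * k * (2 * c) * (n + k + 1) + (2 * n + 1) * c + (2 * k + 1) * c
                        ≡ 2 * ((2 * k + 1) * c * (n + k + 1))
    collect = solve-∀

  -- R k n = (2n+1)/(2n+2) · (1/(n+1+k) + R k (n+1)), cleared of denominators
  telescoping-lhs telescoping-rhs : ℕ → ℕ → ℕ
  telescoping-lhs k n = (2 * n + 1) * (q k (suc n) + (suc n + k) * p k (suc n)) * q k n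
  telescoping-rhs k n = (2 * n + 2) * (suc n + k) * q k (suc n) * p k n

  telescoping-suc : ∀ k n → k * telescoping-lhs k n ≡ k * telescoping-rhs k n →
                    telescoping-lhs (suc k) n ≡ telescoping-rhs (suc k) n
  telescoping-suc k n eq = +-cancelʳ-≡ _ _ _ (begin
    telescoping-lhs (suc k) n + w * (k * telescoping-rhs k n)
      ≡⟨ invariant n k (p k n) (p k (suc n)) (q k n) (q k (suc n)) ⟩
    telescoping-rhs (suc k) n + w * (k * telescoping-lhs k n)
      ≡⟨ cong (λ e → telescoping-rhs (suc k) n + w * e) eq ⟩
    telescoping-rhs (suc k) n + w * (k * telescoping-rhs k n)
      ∎)
    where
    open ≡-Reasoning
    w = 2 * (2 * k + 1) * ((suc n + k + 1) * (suc n + k + 1))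
    invariant : ∀ n k a b c d →
      (2 * n + 1) * ((2 * k + 1) * d * (suc n + k + 1) + (suc n + suc k) * (2 * k * b * (suc n + k + 1) + (2 * suc n + 1) * d)) * ((2 * k + 1) * c * (n + k + 1))
        + 2 * (2 * k + 1) * ((suc n + k + 1) * (suc n + k + 1)) * (k * ((2 * n + 2) * (suc n + k) * d * a))
      ≡ (2 * n + 2) * (suc n + suc k) * ((2 * k + 1) * d * (suc n + k + 1)) * (2 * k * a * (n + k + 1) + (2 * n + 1) * c)
        + 2 * (2 * k + 1) * ((suc n + k + 1) * (suc n + k + 1)) * (k * ((2 * n + 1) * (d + (suc n + k) * b) * c))
    invariant = solve-∀

  telescoping : ∀ k n → telescoping-lhs (suc k) n ≡ telescoping-rhs (suc k) n
  -- R 0 = 0 does not telescope, but only its multiple by k = 0 is needed.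
  telescoping zero    n = telescoping-suc 0 n refl
  telescoping (suc k) n = telescoping-suc (suc k) n (cong (suc k *_) (telescoping k n))

  ratio-at-zero : ∀ k → (p k 0 * k + q k 0) * central k ≡ 4 ^ k * q k 0
  ratio-at-zero zero    = refl
  ratio-at-zero (suc k) = *-cancelˡ-≡ _ _ (suc k) (begin
    suc k * ((p′ * suc k + q′) * central (suc k))
      ≡⟨ x*[y*z]≡y*[x*z] (suc k) (p′ * suc k + q′) (central (suc k)) ⟩
    (p′ * suc k + q′) * (suc k * central (suc k))
      ≡⟨ cong ((p′ * suc k + q′) *_) (central-suc k) ⟩
    (p′ * suc k + q′) * (2 * (2 * k + 1) * central k)
      ≡⟨ unfold-suc k (p k 0) (q k 0) (central k) ⟩
    4 * (2 * k + 1) * (suc k * suc k) * ((p k 0 * k + q k 0) * central k)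
      ≡⟨ cong (4 * (2 * k + 1) * (suc k * suc k) *_) (ratio-at-zero k) ⟩
    4 * (2 * k + 1) * (suc k * suc k) * (4 ^ k * q k 0)
      ≡⟨ fold-suc k (q k 0) (4 ^ k) ⟩
    suc k * (4 ^ suc k * q′)
      ∎)
    where
    open ≡-Reasoning
    p′ = p (suc k) 0
    q′ = q (suc k) 0
    x*[y*z]≡y*[x*z] : ∀ x y z → x * (y * z) ≡ y * (x * z)
    x*[y*z]≡y*[x*z] = solve-∀
    unfold-suc : ∀ k a c b → ((2 * k * a * (0 + k + 1) + (2 * 0 + 1) * c) * suc k + (2 * k + 1) * c * (0 + k + 1)) * (2 * (2 * k + 1) * b)
                             ≡ 4 * (2 * k + 1) * (suc k * suc k) * ((a * k + c) * b)
    unfold-suc = solve-∀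
    fold-suc : ∀ k c x → 4 * (2 * k + 1) * (suc k * suc k) * (x * c) ≡ suc k * ((4 * x) * ((2 * k + 1) * c * (0 + k + 1)))
    fold-suc = solve-∀

  tail-recurrence : ∀ k n → let m = suc n + suc k in
    central (suc n) * (q (suc k) (suc n) + m * p (suc k) (suc n)) * q (suc k) n
      ≡ 4 * central n * p (suc k) n * m * q (suc k) (suc n)
  tail-recurrence k n = *-cancelˡ-≡ _ _ (suc n) (begin
    suc n * (c′ * a * q₀)
      ≡⟨ regroup (suc n) c′ a q₀ ⟩
    (suc n * c′) * (a * q₀)
      ≡⟨ cong (_* (a * q₀)) (central-suc n) ⟩
    (2 * (2 * n + 1) * c) * (a * q₀)
      ≡⟨ move-in n c a q₀ ⟩
    2 * c * telescoping-lhs (suc k) n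
      ≡⟨ cong (2 * c *_) (telescoping k n) ⟩
    2 * c * telescoping-rhs (suc k) n
      ≡⟨ move-out n c m q₁ p₀ ⟩
    suc n * (4 * c * p₀ * m * q₁)
      ∎)
    where
    open ≡-Reasoning
    m = suc n + suc k
    c = central n
    c′ = central (suc n)
    q₀ = q (suc k) n
    q₁ = q (suc k) (suc n)
    p₀ = p (suc k) n
    a = q₁ + m * p (suc k) (suc n)
    regroup : ∀ x y a b → x * (y * a * b) ≡ (x * y) * (a * b)
    regroup = solve-∀
    move-in : ∀ n c a b → (2 * (2 * n + 1) * c) * (a * b) ≡ 2 * c * ((2 * n + 1) * a * b)
    move-in = solve-∀
    move-out : ∀ n c m x y → 2 * c * ((2 * n + 2) * m * x * y) ≡ suc n * (4 * c * y * m * x)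
    move-out = solve-∀

  tail-numerator-bound : ∀ k m n → 2 * m * m ≤ n → central n * p k n * m < 4 ^ n * q k n
  tail-numerator-bound k m n 2m²≤n = begin-strict
    central n * p k n * m
      ≤⟨ *-monoˡ-≤ m (*-monoʳ-≤ (central n) (p≤2q k n)) ⟩
    central n * (2 * q k n) * m
      ≡⟨ regroup (central n) (q k n) m ⟩
    q k n * (2 * m * central n)
      <⟨ *-monoʳ-< (q k n) {{q≢0 k n}} (2*m*central<4^n m n 2m²≤n) ⟩
    q k n * 4 ^ n
      ≡⟨ *-comm (q k n) (4 ^ n) ⟩
    4 ^ n * q k n
      ∎
    where
    open ≤-Reasoning
    regroup : ∀ c q m → c * (2 * q) * m ≡ q * (2 * m * c)
    regroup = solve-∀

module Fraction where
  open import Data.Nat as ℕ using (ℕ; suc; NonZero)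
  import Data.Nat.Properties as ℕ
  open import Data.Integer as ℤ using (+_; +<+; +≤+)
  import Data.Integer.Properties as ℤ
  open import Data.Rational using (ℚ; _/_; _+_; _*_; _<_; _≤_; toℚᵘ)
  open import Data.Rational.Properties
  import Data.Rational.Unnormalised as ℚᵘ
  import Data.Rational.Unnormalised.Properties as ℚᵘ
  open import Relation.Binary.PropositionalEquality

  frac : ℕ → (b : ℕ) → .{{NonZero b}} → ℚ
  frac a b = + a / b

  toℚᵘ-frac : ∀ a b .{{_ : NonZero b}} → toℚᵘ (frac a b) ℚᵘ.≃ (+ a ℚᵘ./ b)
  toℚᵘ-frac a (suc b) = toℚᵘ-fromℚᵘ (+ a ℚᵘ./ suc b)

  +a*+b≡+[a*b] : ∀ a b → + a ℤ.* + b ≡ + (a ℕ.* b)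
  +a*+b≡+[a*b] a b = sym (ℤ.pos-* a b)

  frac-≡ : ∀ a b c d .{{_ : NonZero b}} .{{_ : NonZero d}} → a ℕ.* d ≡ c ℕ.* b → frac a b ≡ frac c d
  frac-≡ a b@(suc _) c d@(suc _) ad≡cb = toℚᵘ-injective (ℚᵘ.≃-trans (toℚᵘ-frac a b)
    (ℚᵘ.≃-trans (ℚᵘ.*≡* (trans (+a*+b≡+[a*b] a d) (trans (cong +_ ad≡cb) (sym (+a*+b≡+[a*b] c b))))) (ℚᵘ.≃-sym (toℚᵘ-frac c d))))

  frac-+ : ∀ a b c d .{{_ : NonZero b}} .{{_ : NonZero d}} →
           frac a b + frac c d ≡ frac (a ℕ.* d ℕ.+ c ℕ.* b) (b ℕ.* d) {{ℕ.m*n≢0 b d}}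
  frac-+ a b@(suc _) c d@(suc _) = toℚᵘ-injective (ℚᵘ.≃-trans (toℚᵘ-homo-+ (frac a b) (frac c d))
    (ℚᵘ.≃-trans (ℚᵘ.+-cong (toℚᵘ-frac a b) (toℚᵘ-frac c d))
    (ℚᵘ.≃-trans (ℚᵘ.≃-reflexive (cong (ℚᵘ._/ (b ℕ.* d)) numerator)) (ℚᵘ.≃-sym (toℚᵘ-frac _ (b ℕ.* d))))))
    where
    numerator : + a ℤ.* + d ℤ.+ + c ℤ.* + b ≡ + (a ℕ.* d ℕ.+ c ℕ.* b)
    numerator = trans (cong₂ ℤ._+_ (+a*+b≡+[a*b] a d) (+a*+b≡+[a*b] c b)) (sym (ℤ.pos-+ (a ℕ.* d) (c ℕ.* b)))

  frac-* : ∀ a b c d .{{_ : NonZero b}} .{{_ : NonZero d}} →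
           frac a b * frac c d ≡ frac (a ℕ.* c) (b ℕ.* d) {{ℕ.m*n≢0 b d}}
  frac-* a b@(suc _) c d@(suc _) = toℚᵘ-injective (ℚᵘ.≃-trans (toℚᵘ-homo-* (frac a b) (frac c d))
    (ℚᵘ.≃-trans (ℚᵘ.*-cong (toℚᵘ-frac a b) (toℚᵘ-frac c d))
    (ℚᵘ.≃-trans (ℚᵘ.≃-reflexive (cong (ℚᵘ._/ (b ℕ.* d)) (+a*+b≡+[a*b] a c))) (ℚᵘ.≃-sym (toℚᵘ-frac _ (b ℕ.* d))))))

  frac-< : ∀ a b c d .{{_ : NonZero b}} .{{_ : NonZero d}} → a ℕ.* d ℕ.< c ℕ.* b → frac a b < frac c d
  frac-< a b@(suc _) c d@(suc _) ad<cb = toℚᵘ-cancel-<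
    (ℚᵘ.<-respʳ-≃ (ℚᵘ.≃-sym (toℚᵘ-frac c d)) (ℚᵘ.<-respˡ-≃ (ℚᵘ.≃-sym (toℚᵘ-frac a b))
      (ℚᵘ.*<* (subst₂ ℤ._<_ (sym (+a*+b≡+[a*b] a d)) (sym (+a*+b≡+[a*b] c b)) (+<+ ad<cb)))))

  frac-≤ : ∀ a b c d .{{_ : NonZero b}} .{{_ : NonZero d}} → a ℕ.* d ℕ.≤ c ℕ.* b → frac a b ≤ frac c d
  frac-≤ a b@(suc _) c d@(suc _) ad≤cb = toℚᵘ-cancel-≤
    (ℚᵘ.≤-respʳ-≃ (ℚᵘ.≃-sym (toℚᵘ-frac c d)) (ℚᵘ.≤-respˡ-≃ (ℚᵘ.≃-sym (toℚᵘ-frac a b))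
      (ℚᵘ.*≤* (subst₂ ℤ._≤_ (sym (+a*+b≡+[a*b] a d)) (sym (+a*+b≡+[a*b] c b)) (+≤+ ad≤cb)))))

  frac-+-≡ : ∀ a b c d e f .{{_ : NonZero b}} .{{_ : NonZero d}} .{{_ : NonZero f}} →
             (a ℕ.* d ℕ.+ c ℕ.* b) ℕ.* f ≡ e ℕ.* (b ℕ.* d) → frac a b + frac c d ≡ frac e f
  frac-+-≡ a b c d e f eq = trans (frac-+ a b c d) (frac-≡ (a ℕ.* d ℕ.+ c ℕ.* b) (b ℕ.* d) e f {{ℕ.m*n≢0 b d}} eq)

  frac-*-≡ : ∀ a b c d e f .{{_ : NonZero b}} .{{_ : NonZero d}} .{{_ : NonZero f}} →
             a ℕ.* c ℕ.* f ≡ e ℕ.* (b ℕ.* d) → frac a b * frac c d ≡ frac e f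
  frac-*-≡ a b c d e f eq = trans (frac-* a b c d) (frac-≡ (a ℕ.* c) (b ℕ.* d) e f {{ℕ.m*n≢0 b d}} eq)

module Tail where
  open import Data.Nat as ℕ using (ℕ; zero; suc; NonZero; z≤n)
  import Data.Nat.Properties as ℕ
  open import Data.Nat.Tactic.RingSolver using (solve-∀)
  import Data.Integer as ℤ
  open import Data.Product using (∃-syntax; _,_)
  open import Data.Rational using (ℚ; mkℚ; 0ℚ; _+_; _*_; _-_; -_; _<_; _≤_; ∣_∣; positive)
  open import Data.Rational.Properties using (+-assoc; +-identityˡ; ∣-p∣≡∣p∣; 0≤p⇒∣p∣≡p; ↥p/↧p≡p)
  open import Data.Rational.Solver using (module +-*-Solver)
  open import Relation.Binary.PropositionalEquality
  open TailRatio
  open Fraction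

  4^n≢0 : ∀ n → NonZero (4 ℕ.^ n)
  4^n≢0 n = ℕ.m^n≢0 4 n

  4^n*q≢0 : ∀ k n → NonZero (4 ℕ.^ n ℕ.* q k n)
  4^n*q≢0 k n = ℕ.m*n≢0 _ _ {{4^n≢0 n}} {{q≢0 k n}}

  tail : ℕ → ℕ → ℚ
  tail k n = frac (central n ℕ.* p k n) (4 ℕ.^ n ℕ.* q k n) {{4^n*q≢0 k n}}

  term≡frac : ∀ k n → let m = suc n ℕ.+ k; z = 4 ℕ.^ suc n in
              term k n ≡ frac (central (suc n)) (m ℕ.* z) {{ℕ.m*n≢0 m z {{_}} {{4^n≢0 (suc n)}}}}
  term≡frac k n = trans
    (cong (_* frac 1 z {{4^n≢0 (suc n)}}) (frac-*-≡ 1 m c 1 c m (units c m)))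
    (frac-*-≡ c m 1 z c (m ℕ.* z) {{_}} {{4^n≢0 (suc n)}} {{ℕ.m*n≢0 m z {{_}} {{4^n≢0 (suc n)}}}}
              (drop-unit c (m ℕ.* z)))
    where
    m = suc n ℕ.+ k
    z = 4 ℕ.^ suc n
    c = central (suc n)
    units : ∀ c m → 1 ℕ.* c ℕ.* m ≡ c ℕ.* (m ℕ.* 1)
    units = solve-∀
    drop-unit : ∀ c x → c ℕ.* 1 ℕ.* x ≡ c ℕ.* x
    drop-unit = solve-∀

  term+tail-suc≡tail : ∀ k n → term (suc k) n + tail (suc k) (suc n) ≡ tail (suc k) n
  term+tail-suc≡tail k n = trans (cong (_+ tail (suc k) (suc n)) (term≡frac (suc k) n))
    (frac-+-≡ c′ (m ℕ.* (4 ℕ.* z)) (c′ ℕ.* p₁) (4 ℕ.* z ℕ.* q₁) (c ℕ.* p₀) (z ℕ.* q₀)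
       {{ℕ.m*n≢0 m (4 ℕ.* z) {{_}} {{4^n≢0 (suc n)}}}} {{4^n*q≢0 (suc k) (suc n)}} {{4^n*q≢0 (suc k) n}} (begin
       (c′ ℕ.* (4 ℕ.* z ℕ.* q₁) ℕ.+ c′ ℕ.* p₁ ℕ.* (m ℕ.* (4 ℕ.* z))) ℕ.* (z ℕ.* q₀)
         ≡⟨ factor c′ m z p₁ q₀ q₁ ⟩
       4 ℕ.* z ℕ.* z ℕ.* (c′ ℕ.* (q₁ ℕ.+ m ℕ.* p₁) ℕ.* q₀)
         ≡⟨ cong (4 ℕ.* z ℕ.* z ℕ.*_) (tail-recurrence k n) ⟩
       4 ℕ.* z ℕ.* z ℕ.* (4 ℕ.* c ℕ.* p₀ ℕ.* m ℕ.* q₁)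
         ≡⟨ unfactor c p₀ m z q₁ ⟩
       c ℕ.* p₀ ℕ.* (m ℕ.* (4 ℕ.* z) ℕ.* (4 ℕ.* z ℕ.* q₁))
         ∎))
    where
    open ≡-Reasoning
    m = suc n ℕ.+ suc k
    z = 4 ℕ.^ n
    c = central n
    c′ = central (suc n)
    p₀ = p (suc k) n
    p₁ = p (suc k) (suc n)
    q₀ = q (suc k) n
    q₁ = q (suc k) (suc n)
    factor : ∀ c m z p₁ q₀ q₁ → (c ℕ.* (4 ℕ.* z ℕ.* q₁) ℕ.+ c ℕ.* p₁ ℕ.* (m ℕ.* (4 ℕ.* z))) ℕ.* (z ℕ.* q₀)
                                ≡ 4 ℕ.* z ℕ.* z ℕ.* (c ℕ.* (q₁ ℕ.+ m ℕ.* p₁) ℕ.* q₀)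
    factor = solve-∀
    unfactor : ∀ c p m z q → 4 ℕ.* z ℕ.* z ℕ.* (4 ℕ.* c ℕ.* p ℕ.* m ℕ.* q)
                             ≡ c ℕ.* p ℕ.* (m ℕ.* (4 ℕ.* z) ℕ.* (4 ℕ.* z ℕ.* q))
    unfactor = solve-∀

  4^k/[k*central] : (k : ℕ) → .{{NonZero k}} → ℚ
  4^k/[k*central] k = frac 1 k * frac 1 (central k) {{central≢0 k}} * frac (4 ℕ.^ k) 1

  tail₀+1/k≡4^k/[k*central] : ∀ k → tail (suc k) 0 + frac 1 (suc k) ≡ 4^k/[k*central] (suc k)
  tail₀+1/k≡4^k/[k*central] k = begin
    tail K 0 + frac 1 K
      ≡⟨ frac-+-≡ (1 ℕ.* p K 0) (1 ℕ.* q K 0) 1 K (4 ℕ.^ K) (K ℕ.* central K)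
                  {{4^n*q≢0 K 0}} {{_}} {{K*c≢0}} (begin
         (1 ℕ.* p K 0 ℕ.* K ℕ.+ 1 ℕ.* (1 ℕ.* q K 0)) ℕ.* (K ℕ.* central K)
           ≡⟨ factor K (p K 0) (q K 0) (central K) ⟩
         K ℕ.* ((p K 0 ℕ.* K ℕ.+ q K 0) ℕ.* central K)
           ≡⟨ cong (K ℕ.*_) (ratio-at-zero K) ⟩
         K ℕ.* (4 ℕ.^ K ℕ.* q K 0)
           ≡⟨ unfactor K (q K 0) (4 ℕ.^ K) ⟩
         4 ℕ.^ K ℕ.* (1 ℕ.* q K 0 ℕ.* K)
           ∎) ⟩
    frac (4 ℕ.^ K) (K ℕ.* central K) {{K*c≢0}}
      ≡⟨ frac-*-≡ 1 (K ℕ.* central K) (4 ℕ.^ K) 1 (4 ℕ.^ K) (K ℕ.* central K)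
                  {{K*c≢0}} {{_}} {{K*c≢0}} (units (4 ℕ.^ K) (K ℕ.* central K)) ⟨
    frac 1 (K ℕ.* central K) {{K*c≢0}} * frac (4 ℕ.^ K) 1
      ≡⟨ cong (_* frac (4 ℕ.^ K) 1) (frac-*-≡ 1 K 1 (central K) 1 (K ℕ.* central K)
                  {{_}} {{central≢0 K}} {{K*c≢0}} refl) ⟨
    4^k/[k*central] K
      ∎
    where
    open ≡-Reasoning
    K = suc k
    K*c≢0 : NonZero (K ℕ.* central K)
    K*c≢0 = ℕ.m*n≢0 K (central K) {{_}} {{central≢0 K}}
    factor : ∀ K a c b → (1 ℕ.* a ℕ.* K ℕ.+ 1 ℕ.* (1 ℕ.* c)) ℕ.* (K ℕ.* b) ≡ K ℕ.* ((a ℕ.* K ℕ.+ c) ℕ.* b)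
    factor = solve-∀
    unfactor : ∀ K c x → K ℕ.* (x ℕ.* c) ≡ x ℕ.* (1 ℕ.* c ℕ.* K)
    unfactor = solve-∀
    units : ∀ x y → 1 ℕ.* x ℕ.* y ≡ x ℕ.* (y ℕ.* 1)
    units = solve-∀

  partialSum+tail+1/k≡4^k/[k*central] : ∀ k n →
    partialSum (suc k) n + tail (suc k) n + frac 1 (suc k) ≡ 4^k/[k*central] (suc k)
  partialSum+tail+1/k≡4^k/[k*central] k zero    =
    trans (cong (_+ frac 1 (suc k)) (+-identityˡ (tail (suc k) 0))) (tail₀+1/k≡4^k/[k*central] k)
  partialSum+tail+1/k≡4^k/[k*central] k (suc n) = trans (cong (_+ frac 1 (suc k)) (begin
    partialSum (suc k) n + term (suc k) n + tail (suc k) (suc n)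
      ≡⟨ +-assoc (partialSum (suc k) n) (term (suc k) n) (tail (suc k) (suc n)) ⟩
    partialSum (suc k) n + (term (suc k) n + tail (suc k) (suc n))
      ≡⟨ cong (partialSum (suc k) n +_) (term+tail-suc≡tail k n) ⟩
    partialSum (suc k) n + tail (suc k) n
      ∎)) (partialSum+tail+1/k≡4^k/[k*central] k n)
    where open ≡-Reasoning

  ∣partialSum-rhs∣≡tail : ∀ k n → ∣ partialSum (suc k) n - rhs (suc k) ∣ ≡ tail (suc k) n
  ∣partialSum-rhs∣≡tail k n = begin
    ∣ s - (4^k/[k*central] (suc k) - u) ∣
      ≡⟨ cong (λ x → ∣ s - (x - u) ∣) (partialSum+tail+1/k≡4^k/[k*central] k n) ⟨
    ∣ s - ((s + t + u) - u) ∣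
      ≡⟨ cong ∣_∣ (cancel s t u) ⟩
    ∣ - t ∣
      ≡⟨ ∣-p∣≡∣p∣ t ⟩
    ∣ t ∣
      ≡⟨ 0≤p⇒∣p∣≡p (frac-≤ 0 1 (central n ℕ.* p (suc k) n) (4 ℕ.^ n ℕ.* q (suc k) n)
                           {{_}} {{4^n*q≢0 (suc k) n}} z≤n) ⟩
    t
      ∎
    where
    open ≡-Reasoning
    s = partialSum (suc k) n
    t = tail (suc k) n
    u = frac 1 (suc k)
    cancel : ∀ s t u → s - ((s + t + u) - u) ≡ - t
    cancel = +-*-Solver.solve 3 (λ s t u → s :- ((s :+ t :+ u) :- u) := :- t) refl
      where open +-*-Solver

  tail<1/m : ∀ k m n .{{_ : NonZero m}} → 2 ℕ.* m ℕ.* m ℕ.≤ n → tail k n < frac 1 m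
  tail<1/m k m n 2m²≤n = frac-< (central n ℕ.* p k n) (4 ℕ.^ n ℕ.* q k n) 1 m {{4^n*q≢0 k n}}
    (ℕ.<-≤-trans (tail-numerator-bound k m n 2m²≤n) (ℕ.≤-reflexive (sym (ℕ.*-identityˡ _))))

  positive⇒∃1/[1+d]≤ : ∀ ε → 0ℚ < ε → ∃[ d ] frac 1 (suc d) ≤ ε
  positive⇒∃1/[1+d]≤ ε@(mkℚ ℤ.+[1+ a ] d _) _ =
    d , subst (frac 1 (suc d) ≤_) (↥p/↧p≡p ε)
              (frac-≤ 1 (suc d) (suc a) (suc d) (ℕ.*-monoˡ-≤ (suc d) (ℕ.s≤s (z≤n {a}))))
  positive⇒∃1/[1+d]≤ (mkℚ (ℤ.+ 0)    _ _) 0<ε with positive 0<ε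
  ... | ()
  positive⇒∃1/[1+d]≤ (mkℚ ℤ.-[1+ _ ] _ _) 0<ε with positive 0<ε
  ... | ()

open import Data.Nat using (ℕ; NonZero; _≤_; suc; _*_)
open import Data.Product using (∃-syntax; _,_)
open import Data.Rational using (ℚ; 0ℚ; _<_; _-_; ∣_∣)
open import Data.Rational.Properties using (<-≤-trans)
open import Relation.Binary.PropositionalEquality using (subst; sym)
open Tail

lemma1 : (k : ℕ) → .{{_ : NonZero k}} → (ε : ℚ) → 0ℚ < ε → ∃[ N ] ((n : ℕ) → N ≤ n → ∣ partialSum k n - rhs k ∣ < ε)
lemma1 (suc k) ε 0<ε with positive⇒∃1/[1+d]≤ ε 0<ε
... | d , 1/[1+d]≤ε = 2 * suc d * suc d , λ n 2[1+d]²≤n →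
  subst (_< ε) (sym (∣partialSum-rhs∣≡tail k n)) (<-≤-trans (tail<1/m (suc k) (suc d) n 2[1+d]²≤n) 1/[1+d]≤ε)
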